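{- Let $\varphi$ be a skew morphism of an abelian group $B$. If $\varphi(a)=a$ for some $a\in B$, then $a\in\ker\varphi$.
   Context: For a finite group $B$, a skew morphism of $B$ is a permutation $\varphi$ of $B$ fixing the identity such that for every $a\in B$ there is a positive integer $i_a$ with $\varphi(ab)=\varphi(a)\varphi^{i_a}(b)$ for all $b\in B$. The power function $\pi$ maps $a$ to the unique such $i_a\in\{1,\dots,\mathrm{ord}(\varphi)\}$, where $\mathrm{ord}(\varphi)$ is the order of $\langle\varphi\rangle$ (with $\pi\equiv1$ if $\varphi$ is the identity); the kernel is $\ker\varphi=\{a\in B:\pi(a)=1\}$. All groups are finite. -}

module Defs where

open import Data.Nat using (ℕ; zero; suc; _≥_)
open import Data.Fin using (Fin)
open import Data.Product using (Σ; _×_)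
open import Function.Definitions using (Bijective)
open import Relation.Binary.PropositionalEquality using (_≡_)
open import Algebra.Core using (Op₁; Op₂)
open import Algebra.Structures using (IsAbelianGroup)

iter : ∀ {A : Set} → (A → A) → ℕ → A → A
iter f zero    x = x
iter f (suc i) x = f (iter f i x)

-- A finite abelian group: WLOG carrier Fin n (every finite group is
-- isomorphic to one on Fin n), with propositional equality.
record FiniteAbelianGroup : Set where
  field
    n       : ℕ
    _∙_     : Op₂ (Fin n)
    ε       : Fin n
    _⁻¹     : Op₁ (Fin n)
    isAbelianGroup : IsAbelianGroup _≡_ _∙_ ε _⁻¹

module _ (B : FiniteAbelianGroup) where
  open FiniteAbelianGroup B

  record IsSkewMorphism (φ : Fin n → Fin n) : Set where
    field
      bijective : Bijective _≡_ _≡_ φ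
      fixes-ε   : φ ε ≡ ε
      skew      : ∀ a → Σ ℕ λ i → (i ≥ 1) × (∀ b → φ (a ∙ b) ≡ φ a ∙ iter φ i b)

  -- a ∈ ker φ  ⟺  π(a) = 1. Since π(a) is the unique i ∈ {1,…,ord φ}
  -- with φ(ab) = φ(a)φ^i(b) for all b, and 1 always lies in that range,
  -- π(a) = 1 holds exactly when i = 1 satisfies the defining identity.
  InKernel : (φ : Fin n → Fin n) → Fin n → Set
  InKernel φ a = ∀ b → φ (a ∙ b) ≡ φ a ∙ φ b

-- If φ fixes a, the skew identities for a and for b give φ(ab) = a·φ^π(a)(b)
-- and φ(ba) = φ(b)·a. In an abelian group ab = ba, so a·φ^π(a)(b) = a·φ(b),
-- and cancelling a shows that π(a) may be replaced by 1.
module Submission where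

open import Defs
open import Data.Fin using (Fin)
open import Data.Nat using (zero; suc)
open import Data.Product using (_,_)
open import Algebra.Bundles using (AbelianGroup)
open import Relation.Binary.PropositionalEquality
  using (_≡_; refl; sym; trans; cong; module ≡-Reasoning)
import Algebra.Properties.Group as GroupProperties

iter-fixed : ∀ {A : Set} (f : A → A) {a : A} → f a ≡ a → ∀ k → iter f k a ≡ a
iter-fixed f fa zero    = refl
iter-fixed f fa (suc k) = trans (cong f (iter-fixed f fa k)) fa

module _ (B : FiniteAbelianGroup) (φ : Fin (FiniteAbelianGroup.n B) → Fin (FiniteAbelianGroup.n B)) where
  open FiniteAbelianGroup B

  abelianGroup : AbelianGroup _ _
  abelianGroup = record { isAbelianGroup = isAbelianGroup }

  open AbelianGroup abelianGroup using (comm; group)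
  open GroupProperties group using (∙-cancelˡ)

  skew-fixed-right : ∀ j {a b : Fin n} → φ a ≡ a
                     → (∀ c → φ (b ∙ c) ≡ φ b ∙ iter φ j c)
                     → φ (b ∙ a) ≡ φ b ∙ a
  skew-fixed-right j fa hj = trans (hj _) (cong (_ ∙_) (iter-fixed φ fa j))

  fixed⇒power-acts-as-φ : IsSkewMorphism B φ → ∀ i {a : Fin n} → φ a ≡ a
                          → (∀ b → φ (a ∙ b) ≡ φ a ∙ iter φ i b)
                          → ∀ b → iter φ i b ≡ φ b
  fixed⇒power-acts-as-φ sk i {a} fa hi b with IsSkewMorphism.skew sk b
  ... | j , _ , hj = ∙-cancelˡ a (iter φ i b) (φ b) (begin
    a ∙ iter φ i b    ≡⟨ cong (_∙ iter φ i b) (sym fa) ⟩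
    φ a ∙ iter φ i b  ≡⟨ sym (hi b) ⟩
    φ (a ∙ b)         ≡⟨ cong φ (comm a b) ⟩
    φ (b ∙ a)         ≡⟨ skew-fixed-right j fa hj ⟩
    φ b ∙ a           ≡⟨ comm (φ b) a ⟩
    a ∙ φ b           ∎)
    where open ≡-Reasoning

lemma2p12 : (B : FiniteAbelianGroup) (φ : Fin (FiniteAbelianGroup.n B) → Fin (FiniteAbelianGroup.n B))
            → IsSkewMorphism B φ
            → (a : Fin (FiniteAbelianGroup.n B)) → φ a ≡ a
            → InKernel B φ a
lemma2p12 B φ sk a fa b with IsSkewMorphism.skew sk a
... | i , _ , hi = trans (hi b) (cong (φ a ∙_) (fixed⇒power-acts-as-φ B φ sk i fa hi b))
  where open FiniteAbelianGroup B
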